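{- Let $b$ be a positive integer, let $T$ be a tree with at least $2$ vertices, and let $A\subseteq V(T)$. Then the following are equivalent: (i) In the $(b:1)$ game on $T$ in which Staller moves first, Dominator has a strategy, claiming only vertices of $V(T)\setminus A$, to dominate all vertices of $V(T)\setminus N[A]$; (ii) $T$ is $(A,b)$-good.
   Context: The $(b:1)$ game on $T$: Dominator and Staller alternately claim previously unclaimed vertices of $T$; in each of her turns Dominator claims up to $b$ vertices, in each of his turns Staller claims one vertex. A vertex is dominated by Dominator if it or one of its neighbours is claimed by Dominator. $N(v)$ is the neighbourhood of $v$ in $T$, $N[A]=A\cup\bigcup_{a\in A}N(a)$. For a forest $F$, $L(F)$ is its set of leaves (vertices of degree $1$). For a sequence $\mathbf v=(v_1,\dots,v_t)$ of distinct vertices of $V(T)\setminus A$ define $F_0:=T$, $F_i:=F_{i-1}-(\{v_i\}\cup((N(v_i)\cap L(F_{i-1}))\setminus A))$ for $i=1,\dots,t$, and $T_{\downarrow\mathbf v,A}:=F_t$. The sequence $\mathbf v$ is $(A,b)$-admissible for $T$ if $|(N(v_i)\cap L(T_{\downarrow(v_1,\dots,v_{i-1}),A}))\setminus A|=b$ for all $i\in\{1,\dots,t\}$. For $u\notin A$, the sequence $(v_1,\dots,v_t,u)$ is $(A,b)$-problematic for $T$ if $\mathbf v$ is $(A,b)$-admissible for $T$ and $|(N(u)\cap L(T_{\downarrow\mathbf v,A}))\setminus A|\geq b+1$. $T$ is $(A,b)$-good if there is no $(A,b)$-problematic sequence for $T$. -}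

module Defs where

open import Data.Bool using (Bool; true; false)
open import Data.Nat using (ℕ; suc; _≤_; _≥_; _+_)
open import Data.Fin using (Fin)
open import Data.Fin.Subset using (Subset; _∈_; _∉_; _∩_; _∪_; ∁; ∣_∣; ⁅_⁆; ⊥; _⊆_)
open import Data.Vec using (tabulate)
import Data.Vec
import Data.Bool
import Data.Unit
import Data.Fin.Subset
open import Data.List using (List; []; _∷_; _∷ʳ_; length)
open import Data.List.Relation.Unary.All using (All)
open import Data.List.Relation.Unary.Linked using (Linked)
open import Data.List.Relation.Unary.Unique.Propositional using (Unique)
open import Data.List.Membership.Propositional using () renaming (_∉_ to _∉ₗ_)
open import Data.Product using (Σ; ∃; _×_)
open import Data.Sum using (_⊎_)
open import Relation.Binary.PropositionalEquality using (_≡_)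
open import Relation.Nullary using (¬_)

Adj : ℕ → Set
Adj n = Fin n → Fin n → Bool

module _ {n : ℕ} (adj : Adj n) where

  Edge : Fin n → Fin n → Set
  Edge u v = adj u v ≡ true

  data Walk : Fin n → Fin n → Set where
    here : ∀ {u} → Walk u u
    step : ∀ {u w v} → Edge u w → Walk w v → Walk u v

  IsCycle : Fin n → List (Fin n) → Set
  IsCycle v ws = 2 ≤ length ws × Unique (v ∷ ws) × Linked Edge ((v ∷ ws) ∷ʳ v)

  record IsTree : Set where
    field
      symmetric   : ∀ u v → adj u v ≡ adj v u
      irreflexive : ∀ v → adj v v ≡ false
      connected   : ∀ u v → Walk u v
      acyclic     : ∀ v ws → ¬ IsCycle v ws

  N : Fin n → Subset n
  N v = tabulate (adj v)

  InClosedNbhd : Subset n → Fin n → Set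
  InClosedNbhd A v = v ∈ A ⊎ ∃ λ a → a ∈ A × Edge a v

  Dominated : Subset n → Fin n → Set
  Dominated D v = v ∈ D ⊎ ∃ λ w → w ∈ D × Edge v w

  -- Positions: D = Dominator's claimed vertices, S = Staller's.

  module Game (b : ℕ) (A : Subset n) where

    Unclaimed : Subset n → Subset n → Fin n → Set
    Unclaimed D S v = v ∉ D × v ∉ S

    AllClaimed : Subset n → Subset n → Set
    AllClaimed D S = ∀ v → v ∈ D ⊎ v ∈ S

    Goal : Subset n → Set
    Goal D = ∀ v → ¬ InClosedNbhd A v → Dominated D v

    LegalD : Subset n → Subset n → Subset n → Set
    LegalD D S X = ∣ X ∣ ≤ b × (∀ {v} → v ∈ X → Unclaimed D S v × v ∉ A)

    -- Dominator has a winning strategy from the position (D , S);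
    -- WinS: Staller to move, WinD: Dominator to move.
    -- The game ends when all vertices are claimed.
    data WinS (D S : Subset n) : Set
    data WinD (D S : Subset n) : Set

    data WinS D S where
      endS  : AllClaimed D S → Goal D → WinS D S
      moveS : (∃ λ v → Unclaimed D S v) →
              (∀ v → Unclaimed D S v → WinD D (S ∪ ⁅ v ⁆)) → WinS D S

    data WinD D S where
      endD  : AllClaimed D S → Goal D → WinD D S
      moveD : (∃ λ v → Unclaimed D S v) →
              (X : Subset n) → LegalD D S X → WinS (D ∪ X) S → WinD D S

  DominatorWinsStallerFirst : ℕ → Subset n → Set
  DominatorWinsStallerFirst b A = Game.WinS b A ⊥ ⊥

  -- Forests are induced subgraphs of T, given by their vertex sets F.

  deg : Subset n → Fin n → ℕ
  deg F u = ∣ F ∩ N u ∣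

  Leaves : Subset n → Subset n
  Leaves F = tabulate λ u → Data.Bool._∧_ (Data.Vec.lookup F u) (isOne (deg F u))
    where
    isOne : ℕ → Bool
    isOne 1 = true
    isOne _ = false

  module Reduction (A : Subset n) where

    LeafNbrs : Subset n → Fin n → Subset n
    LeafNbrs F v = (N v ∩ Leaves F) ∩ ∁ A

    stepF : Subset n → Fin n → Subset n
    stepF F v = F ∩ ∁ (⁅ v ⁆ ∪ LeafNbrs F v)

    reduce : Subset n → List (Fin n) → Subset n
    reduce F []       = F
    reduce F (v ∷ vs) = reduce (stepF F v) vs

    AdmissibleFrom : ℕ → Subset n → List (Fin n) → Set
    AdmissibleFrom b F []       = Data.Unit.⊤
    AdmissibleFrom b F (v ∷ vs) = ∣ LeafNbrs F v ∣ ≡ b × AdmissibleFrom b (stepF F v) vs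

  T : Subset n
  T = Data.Fin.Subset.⊤

  Admissible : Subset n → ℕ → List (Fin n) → Set
  Admissible A b vs = Unique vs × All (λ v → v ∉ A) vs × Reduction.AdmissibleFrom A b T vs

  Problematic : Subset n → ℕ → List (Fin n) → Fin n → Set
  Problematic A b vs u =
    Admissible A b vs × u ∉ A × u ∉ₗ vs ×
    suc b ≤ ∣ Reduction.LeafNbrs A (Reduction.reduce A T vs) u ∣

  Good : Subset n → ℕ → Set
  Good A b = ¬ (Σ (List (Fin n)) λ vs → ∃ λ u → Problematic A b vs u)

-- (ii) ⇒ (i): Dominator plays a pairing strategy on disjoint stars whose centres and leaves lie
-- outside A, with at most b leaves each, covering V(T) ∖ N[A]: a claimed centre is answered by all
-- its leaves, a claimed leaf by its centre. The stars come from repeatedly pruning a vertex x together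
-- with its leaf neighbours outside A, where x is saturated (exactly b such leaves) if possible and
-- otherwise any vertex of N[A] or with a leaf neighbour. Goodness survives pruning a saturated vertex
-- by definition, and pruning when nothing is saturated because the forest then stays balanced: leaf
-- counts at most b and no two saturated vertices in one component. When nothing can be pruned every
-- vertex left has two neighbours, which is impossible in a nonempty forest.
-- (i) ⇒ (ii): Staller claims the vertices of a problematic sequence in order. Dominator has to answer
-- each one by claiming all its leaf neighbours, since an unclaimed one would end up surrounded by
-- Staller; with exactly b of them this uses up her move and leaves the rest of the forest unclaimed,
-- and at the last vertex she cannot claim all b + 1 leaves.

module Submission where

open import Defs
open import Data.Bool using (Bool; true; false)
import Data.Bool as Bool
open import Data.Empty using (⊥; ⊥-elim)
open import Data.Fin using (Fin; zero; suc)
open import Data.Fin.Properties using (any?) renaming (_≟_ to _≟ᶠ_)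
open import Data.Fin.Subset
  using (Subset; _∈_; _∉_; _∩_; _∪_; ∁; ∣_∣; ⁅_⁆; _⊆_; _⊂_; _-_; Nonempty; Empty)
  renaming (⊥ to ∅)
open import Data.Fin.Subset.Properties
open import Data.List using (List; []; _∷_; _∷ʳ_)
open import Data.List.Relation.Unary.All using (All; []; _∷_)
import Data.List.Relation.Unary.All as All
open import Data.List.Relation.Unary.All.Properties using (¬Any⇒All¬; All¬⇒¬Any)
open import Data.List.Relation.Unary.Any using (here; there)
open import Data.List.Relation.Unary.AllPairs using ([]; _∷_)
open import Data.List.Relation.Unary.Linked using (Linked; []; [-]; _∷_)
open import Data.List.Relation.Unary.Unique.Propositional using (Unique)
open import Data.List.Membership.Propositional using () renaming (_∈_ to _∈ₗ_; _∉_ to _∉ₗ_)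
open import Data.Nat using (ℕ; zero; suc; _+_; _≤_; _<_; z≤n; s≤s; s≤s⁻¹)
open import Data.Nat.Properties
  using (≤-refl; ≤-trans; ≤-reflexive; ≤∧≢⇒<; <-irrefl; <⇒≱; m<n⇒n≢0; n≤1+n; +-suc; +-identityʳ; +-monoˡ-<; <-≤-trans; ≤-<-trans; ≤-antisym; <⇒≤; ≮⇒≥; _≟_; _<?_)
open import Data.Product using (∃; _×_; _,_; proj₁; proj₂)
open import Data.Sum using (_⊎_; inj₁; inj₂; [_,_]′)
open import Data.Unit using (tt)
open import Data.Vec using (_∷_; lookup; tabulate)
open import Data.Vec.Properties using ([]=⇒lookup; lookup⇒[]=; lookup∘tabulate)
open import Relation.Binary.PropositionalEquality
  using (_≡_; _≢_; refl; sym; trans; cong; subst; ≢-sym)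
open import Function using (id; _∘_; case_of_)
open import Relation.Nullary using (¬_; Dec; yes; no; does; contradiction)
open import Relation.Nullary.Decidable using (_×-dec_; _⊎-dec_; ¬?; decidable-stable)

module _ {n : ℕ} where

  x∈tabulate⁺ : (f : Fin n → Bool) {x : Fin n} → f x ≡ true → x ∈ tabulate f
  x∈tabulate⁺ f {x} fx≡true = lookup⇒[]= x (tabulate f) (trans (lookup∘tabulate f x) fx≡true)

  x∈tabulate⁻ : (f : Fin n → Bool) {x : Fin n} → x ∈ tabulate f → f x ≡ true
  x∈tabulate⁻ f {x} x∈ = trans (sym (lookup∘tabulate f x)) ([]=⇒lookup x∈)

  x∈p⇒⁅x⁆⊆p : {p : Subset n} {x : Fin n} → x ∈ p → ⁅ x ⁆ ⊆ p
  x∈p⇒⁅x⁆⊆p {p} {x} x∈p y∈⁅x⁆ = subst (_∈ p) (sym (x∈⁅y⁆⇒x≡y x y∈⁅x⁆)) x∈p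

  x∈p⇒0<∣p∣ : {p : Subset n} {x : Fin n} → x ∈ p → 0 < ∣ p ∣
  x∈p⇒0<∣p∣ {x = x} x∈p = subst (_≤ _) (∣⁅x⁆∣≡1 x) (p⊆q⇒∣p∣≤∣q∣ (x∈p⇒⁅x⁆⊆p x∈p))

  0<∣p∣⇒Nonempty : (p : Subset n) → 0 < ∣ p ∣ → Nonempty p
  0<∣p∣⇒Nonempty p 0<∣p∣ with nonempty? p
  ... | yes nonempty = nonempty
  ... | no empty = contradiction (trans (cong ∣_∣ (Empty-unique empty)) (∣⊥∣≡0 n)) (m<n⇒n≢0 0<∣p∣)

  ∣p∣≡1⇒x≡y : {p : Subset n} {x y : Fin n} → ∣ p ∣ ≡ 1 → x ∈ p → y ∈ p → x ≡ y
  ∣p∣≡1⇒x≡y {p} {x} {y} ∣p∣≡1 x∈p y∈p with x ≟ᶠ y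
  ... | yes x≡y = x≡y
  ... | no x≢y = contradiction (p⊂q⇒∣p∣<∣q∣ ⁅x⁆⊂p) (<-irrefl (trans (∣⁅x⁆∣≡1 x) (sym ∣p∣≡1)))
    where
    ⁅x⁆⊂p : ⁅ x ⁆ ⊂ p
    ⁅x⁆⊂p = x∈p⇒⁅x⁆⊆p x∈p , y , y∈p , λ y∈⁅x⁆ → x≢y (sym (x∈⁅y⁆⇒x≡y x y∈⁅x⁆))

  1<∣p∣⇒∃≢ : (p : Subset n) → 1 < ∣ p ∣ → (y : Fin n) → ∃ λ x → x ∈ p × x ≢ y
  1<∣p∣⇒∃≢ p 1<∣p∣ y with any? (λ x → (x ∈? p) ×-dec ¬? (x ≟ᶠ y))
  ... | yes found = found
  ... | no none = contradiction (subst (∣ p ∣ ≤_) (∣⁅x⁆∣≡1 y) (p⊆q⇒∣p∣≤∣q∣ p⊆⁅y⁆)) (<⇒≱ 1<∣p∣)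
    where
    p⊆⁅y⁆ : p ⊆ ⁅ y ⁆
    p⊆⁅y⁆ {x} x∈p = subst (_∈ ⁅ y ⁆) (sym (decidable-stable (x ≟ᶠ y) λ x≢y → none (x , x∈p , x≢y))) (x∈⁅x⁆ y)

∣p∪⁅x⁆∣≤1+∣p∣ : ∀ {n} (p : Subset n) (x : Fin n) → ∣ p ∪ ⁅ x ⁆ ∣ ≤ suc ∣ p ∣
∣p∪⁅x⁆∣≤1+∣p∣ (true  ∷ p) zero    = s≤s (≤-trans (≤-reflexive (cong ∣_∣ (∪-identityʳ p))) (n≤1+n _))
∣p∪⁅x⁆∣≤1+∣p∣ (false ∷ p) zero    = s≤s (≤-reflexive (cong ∣_∣ (∪-identityʳ p)))
∣p∪⁅x⁆∣≤1+∣p∣ (true  ∷ p) (suc x) = s≤s (∣p∪⁅x⁆∣≤1+∣p∣ p x)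
∣p∪⁅x⁆∣≤1+∣p∣ (false ∷ p) (suc x) = ∣p∪⁅x⁆∣≤1+∣p∣ p x

x∉p∪q⁺ : ∀ {n} {p q : Subset n} {x : Fin n} → x ∉ p → x ∉ q → x ∉ p ∪ q
x∉p∪q⁺ x∉p x∉q x∈p∪q = [ x∉p , x∉q ]′ (x∈p∪q⁻ _ _ x∈p∪q)

p⊆q∧∣q∣≤∣p∣⇒q⊆p : ∀ {n} {p q : Subset n} → p ⊆ q → ∣ q ∣ ≤ ∣ p ∣ → q ⊆ p
p⊆q∧∣q∣≤∣p∣⇒q⊆p {p = p} {q} p⊆q ∣q∣≤∣p∣ {x} x∈q =
  decidable-stable (x ∈? p) λ x∉p → <⇒≱ (p⊂q⇒∣p∣<∣q∣ (p⊆q , x , x∈q , x∉p)) ∣q∣≤∣p∣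

x∉p⇒∣∁[p∪⁅x⁆]∣<∣∁p∣ : ∀ {n} {p : Subset n} {x : Fin n} → x ∉ p → ∣ ∁ (p ∪ ⁅ x ⁆) ∣ < ∣ ∁ p ∣
x∉p⇒∣∁[p∪⁅x⁆]∣<∣∁p∣ {p = p} {x} x∉p =
  p⊂q⇒∣p∣<∣q∣ (p⊆q⇒∁p⊇∁q (p⊆p∪q ⁅ x ⁆) , x , x∉p⇒x∈∁p x∉p , λ x∈∁ → x∈∁p⇒x∉p x∈∁ (x∈p∪q⁺ (inj₂ (x∈⁅x⁆ x))))

other-vertex : ∀ {n} → 2 ≤ n → (v : Fin n) → ∃ λ w → v ≢ w
other-vertex (s≤s (s≤s _)) zero    = suc zero , λ ()
other-vertex (s≤s (s≤s _)) (suc _) = zero , λ ()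

module Graph {n : ℕ} (adj : Adj n) where

  private variable
    v w y z : Fin n
    F : Subset n

  ∈N⁺ : Edge adj v w → w ∈ N adj v
  ∈N⁺ {v = v} = x∈tabulate⁺ (adj v)

  ∈N⁻ : w ∈ N adj v → Edge adj v w
  ∈N⁻ {v = v} = x∈tabulate⁻ (adj v)

  -- Leaves tests deg adj F w against 1 with a local function, which computes once deg adj F w is abstracted.
  ∈Leaves⁻ : w ∈ Leaves adj F → w ∈ F × deg adj F w ≡ 1
  ∈Leaves⁻ {w} {F} w∈L with lookup F w in F[w] | deg adj F w | x∈tabulate⁻ _ w∈L
  ... | true | suc zero | _ = lookup⇒[]= w F F[w] , refl

  ∈Leaves⁺ : w ∈ F → deg adj F w ≡ 1 → w ∈ Leaves adj F
  ∈Leaves⁺ {w} {F} w∈F d≡1 with lookup (Leaves adj F) w in L[w]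
  ... | true = lookup⇒[]= w _ L[w]
  ... | false with lookup F w | []=⇒lookup w∈F | deg adj F w | d≡1 | trans (sym (lookup∘tabulate _ w)) L[w]
  ...   | true | refl | suc zero | refl | ()

  leaf⇒∈ : (F : Subset n) → w ∈ Leaves adj F → w ∈ F
  leaf⇒∈ F w∈L = proj₁ (∈Leaves⁻ {F = F} w∈L)

  leaf-nbr-unique : w ∈ Leaves adj F → y ∈ F → Edge adj w y → z ∈ F → Edge adj w z → y ≡ z
  leaf-nbr-unique {F = F} w∈L y∈F wy z∈F wz =
    ∣p∣≡1⇒x≡y (proj₂ (∈Leaves⁻ {F = F} w∈L)) (x∈p∩q⁺ (y∈F , ∈N⁺ wy)) (x∈p∩q⁺ (z∈F , ∈N⁺ wz))

  non-leaf⇒1<deg : w ∈ F → w ∉ Leaves adj F → y ∈ F → Edge adj w y → 1 < deg adj F w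
  non-leaf⇒1<deg {F = F} w∈F w∉L y∈F wy =
    ≤∧≢⇒< (x∈p⇒0<∣p∣ (x∈p∩q⁺ (y∈F , ∈N⁺ wy))) λ 1≡deg → w∉L (∈Leaves⁺ {F = F} w∈F (sym 1≡deg))

  1<deg⇒other-nbr : (F : Subset n) → 1 < deg adj F w → (y : Fin n) → ∃ λ z → z ∈ F × Edge adj w z × z ≢ y
  1<deg⇒other-nbr {w} F 1<deg y with 1<∣p∣⇒∃≢ (F ∩ N adj w) 1<deg y
  ... | z , z∈ , z≢y = z , proj₁ (x∈p∩q⁻ F _ z∈) , ∈N⁻ (proj₂ (x∈p∩q⁻ F _ z∈)) , z≢y

module Tree {n : ℕ} {adj : Adj n} (tree : IsTree adj) where

  open IsTree tree
  open Graph adj public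
  open import Data.List.Membership.DecPropositional (_≟ᶠ_ {n}) using () renaming (_∈?_ to _∈ₗ?_)

  private variable
    u v w x y : Fin n
    P Q : Fin n → Set

  edge-sym : Edge adj u v → Edge adj v u
  edge-sym {u} {v} uv = trans (symmetric v u) uv

  edge-irrefl : ¬ Edge adj v v
  edge-irrefl {v} vv with trans (sym vv) (irreflexive v)
  ... | ()

  edge⇒≢ : Edge adj u v → u ≢ v
  edge⇒≢ uv refl = edge-irrefl uv

  has-nbr : 2 ≤ n → ∀ v → ∃ λ w → Edge adj v w
  has-nbr 2≤n v = let (w , v≢w) = other-vertex 2≤n v in first-step (connected v w) v≢w
    where
    first-step : Walk adj v w → v ≢ w → ∃ λ z → Edge adj v z
    first-step here        v≢v = contradiction refl v≢v
    first-step (step vz _) _   = _ , vz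

  infixr 5 _∷⟨_⟩_

  data WalkIn (P : Fin n → Set) : Fin n → Fin n → Set where
    [_]    : P v → WalkIn P v v
    _∷⟨_⟩_ : P u → Edge adj u w → WalkIn P w v → WalkIn P u v

  walk-start : WalkIn P u v → P u
  walk-start [ pu ]         = pu
  walk-start (pu ∷⟨ _ ⟩ _) = pu

  map-walk : (∀ {v} → P v → Q v) → WalkIn P u v → WalkIn Q u v
  map-walk f [ pv ]             = [ f pv ]
  map-walk f (pu ∷⟨ uw ⟩ walk) = f pu ∷⟨ uw ⟩ map-walk f walk

  _++ʷ_ : WalkIn P u v → WalkIn P v w → WalkIn P u w
  [ _ ]             ++ʷ walk′ = walk′
  (pu ∷⟨ uw ⟩ walk) ++ʷ walk′ = pu ∷⟨ uw ⟩ (walk ++ʷ walk′)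

  reverse-walk : WalkIn P u v → WalkIn P v u
  reverse-walk [ pv ]            = [ pv ]
  reverse-walk (pu ∷⟨ uw ⟩ walk) = reverse-walk walk ++ʷ (walk-start walk ∷⟨ edge-sym uw ⟩ [ pu ])

  lastOf : Fin n → List (Fin n) → Fin n
  lastOf u []       = u
  lastOf _ (v ∷ vs) = lastOf v vs

  record PathIn (P : Fin n → Set) (u v : Fin n) : Set where
    constructor path
    field
      rest   : List (Fin n)
      linked : Linked (Edge adj) (u ∷ rest)
      unique : Unique (u ∷ rest)
      inside : All P (u ∷ rest)
      ends   : lastOf u rest ≡ v

  suffix-path : (π : PathIn P u v) → y ∈ₗ u ∷ PathIn.rest π → PathIn P y v
  suffix-path π (here refl) = π
  suffix-path (path (_ ∷ vs) (_ ∷ L) (_ ∷ U) (_ ∷ I) e) (there y∈) = suffix-path (path vs L U I e) y∈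

  walk⇒path : WalkIn P u v → PathIn P u v
  walk⇒path [ pv ] = path [] [-] ([] ∷ []) (pv ∷ []) refl
  walk⇒path (_∷⟨_⟩_ {u = u} pu uw walk) with walk⇒path walk
  ... | π@(path vs L U I e) with u ∈ₗ? (_ ∷ vs)
  ...   | yes u∈ = suffix-path π u∈
  ...   | no u∉  = path (_ ∷ vs) (uw ∷ L) (¬Any⇒All¬ _ u∉ ∷ U) (pu ∷ I) e

  linked-snoc : ∀ vs → Linked (Edge adj) (u ∷ vs) → Edge adj (lastOf u vs) y → Linked (Edge adj) ((u ∷ vs) ∷ʳ y)
  linked-snoc []       _         e = e ∷ [-]
  linked-snoc (_ ∷ vs) (uv ∷ L) e = uv ∷ linked-snoc vs L e

  neighbours-separated : Edge adj x v → Edge adj x w → v ≢ w → ¬ WalkIn (_≢ x) v w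
  neighbours-separated {x} {v} xv xw v≢w walk with walk⇒path walk
  ... | path [] _ _ _ v≡w = v≢w v≡w
  ... | path (u ∷ vs) L U I e =
        acyclic x (v ∷ u ∷ vs)
          (s≤s (s≤s z≤n) , All.map ≢-sym I ∷ U , xv ∷ linked-snoc (u ∷ vs) L (subst (λ z → Edge adj z x) (sym e) (edge-sym xw)))

  -- Walk through F from z, never turning back: P holds the vertices passed so far, all reachable from
  -- the previous vertex q inside P. A neighbour of the current vertex c other than q lying in P would
  -- close a cycle through c, so P grows at every step, which cannot go on for more than n steps.
  min-degree≥2⇒Empty : (F : Subset n) → (∀ {x} → x ∈ F → 1 < deg adj F x) → Empty F
  min-degree≥2⇒Empty F 1<deg (z , z∈F) with 1<deg⇒other-nbr F (1<deg z∈F) z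
  ... | q , _ , zq , _ =
        grow n ⁅ q ⁆ (subst (λ k → n < k + n) (sym (∣⁅x⁆∣≡1 q)) ≤-refl)
          (x∈⁅x⁆ q) (λ z∈⁅q⁆ → edge⇒≢ zq (x∈⁅y⁆⇒x≡y q z∈⁅q⁆)) z∈F (edge-sym zq)
          λ {y} y∈⁅q⁆ → subst (WalkIn _ q) (sym (x∈⁅y⁆⇒x≡y q y∈⁅q⁆)) [ x∈⁅x⁆ q ]
    where
    grow : ∀ fuel (P : Subset n) {q c} → n < ∣ P ∣ + fuel → q ∈ P → c ∉ P → c ∈ F → Edge adj q c →
           (∀ {y} → y ∈ P → WalkIn (_∈ P) q y) → ⊥
    grow zero P bound _ _ _ _ _ =
      <⇒≱ bound (subst (_≤ n) (sym (+-identityʳ ∣ P ∣)) (∣p∣≤n P))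
    grow (suc fuel) P {q} {c} bound q∈P c∉P c∈F qc reach with 1<deg⇒other-nbr F (1<deg c∈F) q
    ... | y , y∈F , cy , y≢q with y ∈? P
    ...   | yes y∈P =
            neighbours-separated (edge-sym qc) cy (≢-sym y≢q)
              (map-walk (λ v∈P v≡c → c∉P (subst (_∈ P) v≡c v∈P)) (reach y∈P))
    ...   | no y∉P = grow fuel P′ bound′ c∈P′ y∉P′ y∈F cy reach′
      where
      P′ = P ∪ ⁅ c ⁆
      c∈P′ : c ∈ P′
      c∈P′ = x∈p∪q⁺ (inj₂ (x∈⁅x⁆ c))
      bound′ : n < ∣ P′ ∣ + fuel
      bound′ = ≤-<-trans (s≤s⁻¹ (subst (n <_) (+-suc ∣ P ∣ fuel) bound))
                         (+-monoˡ-< fuel (p⊂q⇒∣p∣<∣q∣ (p⊆p∪q ⁅ c ⁆ , c , c∈P′ , c∉P)))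
      y∉P′ : y ∉ P′
      y∉P′ y∈P′ with x∈p∪q⁻ P ⁅ c ⁆ y∈P′
      ... | inj₁ y∈P   = y∉P y∈P
      ... | inj₂ y∈⁅c⁆ = edge⇒≢ cy (sym (x∈⁅y⁆⇒x≡y c y∈⁅c⁆))
      reach′ : ∀ {v} → v ∈ P′ → WalkIn (_∈ P′) c v
      reach′ v∈P′ with x∈p∪q⁻ P ⁅ c ⁆ v∈P′
      ... | inj₁ v∈P   = c∈P′ ∷⟨ edge-sym qc ⟩ map-walk (λ u∈P → x∈p∪q⁺ (inj₁ u∈P)) (reach v∈P)
      ... | inj₂ v∈⁅c⁆ = subst (WalkIn _ c) (sym (x∈⁅y⁆⇒x≡y c v∈⁅c⁆)) [ c∈P′ ]

module Pruning {n : ℕ} {adj : Adj n} (tree : IsTree adj) (A : Subset n) where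

  open Tree tree public
  open Reduction adj A public

  private variable
    F : Subset n
    u v w x y z : Fin n

  leafCount : Subset n → Fin n → ℕ
  leafCount F u = ∣ LeafNbrs F u ∣

  module _ (F : Subset n) {v w : Fin n} (w∈ : w ∈ LeafNbrs F v) where

    leafNbr-edge : Edge adj v w
    leafNbr-edge = ∈N⁻ (proj₁ (x∈p∩q⁻ _ _ (proj₁ (x∈p∩q⁻ _ _ w∈))))

    leafNbr-leaf : w ∈ Leaves adj F
    leafNbr-leaf = proj₂ (x∈p∩q⁻ _ _ (proj₁ (x∈p∩q⁻ _ _ w∈)))

    leafNbr-∉A : w ∉ A
    leafNbr-∉A = x∈∁p⇒x∉p (proj₂ (x∈p∩q⁻ _ _ w∈))

    leafNbr-∈ : w ∈ F
    leafNbr-∈ = leaf⇒∈ F leafNbr-leaf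

  ∈LeafNbrs⁺ : (F : Subset n) → Edge adj v w → w ∈ Leaves adj F → w ∉ A → w ∈ LeafNbrs F v
  ∈LeafNbrs⁺ F vw w∈L w∉A = x∈p∩q⁺ (x∈p∩q⁺ (∈N⁺ vw , w∈L) , x∉p⇒x∈∁p w∉A)

  leafNbr-only-nbr : (F : Subset n) → w ∈ LeafNbrs F x → x ∈ F → y ∈ F → Edge adj w y → y ≡ x
  leafNbr-only-nbr F w∈ x∈F y∈F wy =
    leaf-nbr-unique (leafNbr-leaf F w∈) y∈F wy x∈F (edge-sym (leafNbr-edge F w∈))

  module _ (F : Subset n) {x y : Fin n} (y∈ : y ∈ stepF F x) where

    stepF⊆ : y ∈ F
    stepF⊆ = proj₁ (x∈p∩q⁻ F _ y∈)

    private
      y∉pruned : y ∉ ⁅ x ⁆ ∪ LeafNbrs F x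
      y∉pruned = x∈∁p⇒x∉p (proj₂ (x∈p∩q⁻ F _ y∈))

    ∈stepF⇒≢ : y ≢ x
    ∈stepF⇒≢ y≡x = y∉pruned (x∈p∪q⁺ (inj₁ (subst (_∈ ⁅ x ⁆) (sym y≡x) (x∈⁅x⁆ x))))

    ∈stepF⇒∉LeafNbrs : y ∉ LeafNbrs F x
    ∈stepF⇒∉LeafNbrs y∈L = y∉pruned (x∈p∪q⁺ (inj₂ y∈L))

  x∉stepF : (F : Subset n) → x ∉ stepF F x
  x∉stepF F x∈ = ∈stepF⇒≢ F x∈ refl

  ∈stepF⁺ : y ∈ F → y ≢ x → y ∉ LeafNbrs F x → y ∈ stepF F x
  ∈stepF⁺ {x = x} y∈F y≢x y∉L = x∈p∩q⁺ (y∈F , x∉p⇒x∈∁p λ y∈pruned → case x∈p∪q⁻ ⁅ x ⁆ _ y∈pruned of λ where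
    (inj₁ y∈⁅x⁆) → y≢x (x∈⁅y⁆⇒x≡y x y∈⁅x⁆)
    (inj₂ y∈L)   → y∉L y∈L)

  ∉stepF⇒pruned : y ∈ F → y ∉ stepF F x → y ≡ x ⊎ y ∈ LeafNbrs F x
  ∉stepF⇒pruned {y} {F} {x} y∈F y∉ with y ≟ᶠ x | y ∈? LeafNbrs F x
  ... | yes y≡x | _      = inj₁ y≡x
  ... | no _    | yes y∈L = inj₂ y∈L
  ... | no y≢x  | no y∉L  = contradiction (∈stepF⁺ y∈F y≢x y∉L) y∉

  ∣stepF∣<∣F∣ : x ∈ F → ∣ stepF F x ∣ < ∣ F ∣
  ∣stepF∣<∣F∣ {x} {F} x∈F =
    ≤-<-trans (p⊆q⇒∣p∣≤∣q∣ stepF⊆F-x) (x∈p⇒∣p-x∣<∣p∣ x∈F)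
    where
    stepF⊆F-x : stepF F x ⊆ F - x
    stepF⊆F-x y∈ = x∈p∧x≢y⇒x∈p-y (stepF⊆ F y∈) (∈stepF⇒≢ F y∈)

  pruned-nbr≡x : x ∈ F → y ∈ stepF F x → z ∈ F → z ∉ stepF F x → Edge adj y z → z ≡ x
  pruned-nbr≡x {F = F} x∈F y∈ z∈F z∉ yz with ∉stepF⇒pruned z∈F z∉
  ... | inj₁ z≡x  = z≡x
  ... | inj₂ z∈L = contradiction (leafNbr-only-nbr F z∈L x∈F (stepF⊆ F y∈) (edge-sym yz)) (∈stepF⇒≢ F y∈)

  module _ {F : Subset n} {x u : Fin n} (x∈F : x ∈ F) (u∈ : u ∈ stepF F x) where

    private
      F′ = stepF F x

    new-leaf⇒adjacent : w ∈ LeafNbrs F′ u → w ∉ LeafNbrs F u → Edge adj w x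
    new-leaf⇒adjacent {w} w∈L′ w∉L = adjacent (1<deg⇒other-nbr F (non-leaf⇒1<deg w∈F w∉Leaves u∈F wu) u)
      where
      wu    = edge-sym (leafNbr-edge F′ w∈L′)
      w∈F′  = leafNbr-∈ F′ w∈L′
      w∈F   = stepF⊆ F w∈F′
      u∈F   = stepF⊆ F u∈
      w∉Leaves : w ∉ Leaves adj F
      w∉Leaves w∈Leaves = w∉L (∈LeafNbrs⁺ F (edge-sym wu) w∈Leaves (leafNbr-∉A F′ w∈L′))
      adjacent : (∃ λ z → z ∈ F × Edge adj w z × z ≢ u) → Edge adj w x
      adjacent (z , z∈F , wz , z≢u) with z ∈? F′
      ... | yes z∈F′ = contradiction (leaf-nbr-unique (leafNbr-leaf F′ w∈L′) z∈F′ wz u∈ wu) z≢u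
      ... | no z∉F′  = subst (Edge adj w) (pruned-nbr≡x x∈F w∈F′ z∈F z∉F′ wz) wz

    -- two new leaves of u would close the cycle u, w, x, w′
    new-leaf-unique : w ∈ LeafNbrs F′ u → w ∉ LeafNbrs F u → y ∈ LeafNbrs F′ u → y ∉ LeafNbrs F u → w ≡ y
    new-leaf-unique {w} {y} w∈L′ w∉L y∈L′ y∉L = decidable-stable (w ≟ᶠ y) λ w≢y →
      neighbours-separated (edge-sym (new-leaf⇒adjacent w∈L′ w∉L)) (edge-sym (new-leaf⇒adjacent y∈L′ y∉L)) w≢y
        (map-walk (∈stepF⇒≢ F)
          (leafNbr-∈ F′ w∈L′ ∷⟨ edge-sym (leafNbr-edge F′ w∈L′) ⟩ u∈ ∷⟨ leafNbr-edge F′ y∈L′ ⟩ [ leafNbr-∈ F′ y∈L′ ]))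

    leafNbrs-after-pruning :
        LeafNbrs F′ u ⊆ LeafNbrs F u
      ⊎ ∃ λ w → Edge adj w x × w ∈ LeafNbrs F′ u × leafCount F′ u ≤ suc (leafCount F u)
    leafNbrs-after-pruning with any? (λ w → (w ∈? LeafNbrs F′ u) ×-dec ¬? (w ∈? LeafNbrs F u))
    ... | no none = inj₁ λ {w} w∈L′ → decidable-stable (w ∈? LeafNbrs F u) λ w∉L → none (w , w∈L′ , w∉L)
    ... | yes (w , w∈L′ , w∉L) =
          inj₂ (w , new-leaf⇒adjacent w∈L′ w∉L , w∈L′ ,
                ≤-trans (p⊆q⇒∣p∣≤∣q∣ L′⊆L∪⁅w⁆) (∣p∪⁅x⁆∣≤1+∣p∣ (LeafNbrs F u) w))
      where
      L′⊆L∪⁅w⁆ : LeafNbrs F′ u ⊆ LeafNbrs F u ∪ ⁅ w ⁆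
      L′⊆L∪⁅w⁆ {y} y∈L′ with y ∈? LeafNbrs F u
      ... | yes y∈L = x∈p∪q⁺ (inj₁ y∈L)
      ... | no y∉L  = x∈p∪q⁺ (inj₂ (subst (_∈ ⁅ w ⁆) (new-leaf-unique w∈L′ w∉L y∈L′ y∉L) (x∈⁅x⁆ w)))

  NeedyNotIsolated : Subset n → Set
  NeedyNotIsolated F = ∀ {v} → v ∈ F → ¬ InClosedNbhd adj A v → ∃ λ w → w ∈ F × Edge adj v w

  T-NeedyNotIsolated : 2 ≤ n → NeedyNotIsolated (T adj)
  T-NeedyNotIsolated 2≤n {v} _ _ = let (w , vw) = has-nbr 2≤n v in w , ∈⊤ , vw

  NeedyNotIsolated-prune : x ∈ F → NeedyNotIsolated F → NeedyNotIsolated (stepF F x)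
  NeedyNotIsolated-prune {x} {F} x∈F needy {v} v∈ v-needy with needy (stepF⊆ F v∈) v-needy
  ... | w , w∈F , vw with w ∈? stepF F x
  ...   | yes w∈ = w , w∈ , vw
  ...   | no w∉  = other-nbr (1<deg⇒other-nbr F (non-leaf⇒1<deg (stepF⊆ F v∈) v∉Leaves x∈F vx) x)
    where
    vx : Edge adj v x
    vx = subst (Edge adj v) (pruned-nbr≡x x∈F v∈ w∈F w∉ vw) vw
    v∉Leaves : v ∉ Leaves adj F
    v∉Leaves v∈Leaves = ∈stepF⇒∉LeafNbrs F v∈ (∈LeafNbrs⁺ F (edge-sym vx) v∈Leaves λ v∈A → v-needy (inj₁ v∈A))
    other-nbr : (∃ λ z → z ∈ F × Edge adj v z × z ≢ x) → ∃ λ z → z ∈ stepF F x × Edge adj v z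
    other-nbr (z , z∈F , vz , z≢x) =
      z , decidable-stable (z ∈? stepF F x) (λ z∉ → z≢x (pruned-nbr≡x x∈F v∈ z∈F z∉ vz)) , vz

module Balance {n : ℕ} {adj : Adj n} (tree : IsTree adj) (A : Subset n) (b : ℕ) where

  open Pruning tree A public

  private variable
    F : Subset n
    u v x : Fin n
    vs : List (Fin n)

  Saturated : Subset n → Fin n → Set
  Saturated F u = u ∈ F × u ∉ A × leafCount F u ≡ b

  Connected : Subset n → Fin n → Fin n → Set
  Connected F = WalkIn (_∈ F)

  record Balanced (F : Subset n) : Set where
    field
      leafCount≤b     : ∀ {u} → u ∈ F → u ∉ A → leafCount F u ≤ b
      saturated-apart : ∀ {u t} → Saturated F u → Saturated F t → u ≢ t → ¬ Connected F u t

  record BalancedAwayFrom (x : Fin n) (F : Subset n) : Set where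
    field
      x∈F                    : x ∈ F
      leafCount≤b            : ∀ {u} → u ∈ F → u ∉ A → u ≢ x → leafCount F u ≤ b
      saturated-apart        : ∀ {u t} → Saturated F u → Saturated F t → u ≢ x → t ≢ x → u ≢ t →
                               ¬ Connected F u t
      saturated-apart-from-x : ∀ {u} → Saturated F u → u ≢ x → ¬ Connected F u x

  -- When x is pruned, a vertex u gains at most one leaf w, and then u, w, x is a path in F. So a vertex
  -- saturated in stepF F x was saturated in F or is joined to x through its new leaf; two such vertices
  -- joined in stepF F x contradict the hypotheses or, when both are joined to x, close a cycle.
  pruning-balanced : BalancedAwayFrom x F → Balanced (stepF F x)
  pruning-balanced {x} {F} hyp = record { leafCount≤b = count≤b ; saturated-apart = apart }
    where
    open BalancedAwayFrom hyp
    F′ = stepF F x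

    reaches-x : ∀ {u w} → u ∈ F′ → Edge adj w x → w ∈ LeafNbrs F′ u → Connected F u x
    reaches-x u∈ wx w∈L′ =
      stepF⊆ F u∈ ∷⟨ leafNbr-edge F′ w∈L′ ⟩ stepF⊆ F (leafNbr-∈ F′ w∈L′) ∷⟨ wx ⟩ [ x∈F ]

    was-saturated : ∀ {u} → Saturated F′ u → LeafNbrs F′ u ⊆ LeafNbrs F u → Saturated F u
    was-saturated {u} (u∈ , u∉A , count′≡b) L′⊆L =
      stepF⊆ F u∈ , u∉A ,
      ≤-antisym (leafCount≤b (stepF⊆ F u∈) u∉A (∈stepF⇒≢ F u∈))
                (subst (_≤ leafCount F u) count′≡b (p⊆q⇒∣p∣≤∣q∣ L′⊆L))

    count≤b : ∀ {u} → u ∈ F′ → u ∉ A → leafCount F′ u ≤ b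
    count≤b {u} u∈ u∉A with leafNbrs-after-pruning x∈F u∈
    ... | inj₁ L′⊆L = ≤-trans (p⊆q⇒∣p∣≤∣q∣ L′⊆L) (leafCount≤b (stepF⊆ F u∈) u∉A (∈stepF⇒≢ F u∈))
    ... | inj₂ (w , wx , w∈L′ , count′≤1+count) with leafCount F u ≟ b
    ...   | yes count≡b =
            ⊥-elim (saturated-apart-from-x (stepF⊆ F u∈ , u∉A , count≡b) (∈stepF⇒≢ F u∈) (reaches-x u∈ wx w∈L′))
    ...   | no count≢b =
            ≤-trans count′≤1+count (≤∧≢⇒< (leafCount≤b (stepF⊆ F u∈) u∉A (∈stepF⇒≢ F u∈)) count≢b)

    apart : ∀ {u t} → Saturated F′ u → Saturated F′ t → u ≢ t → ¬ Connected F′ u t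
    apart su@(u∈ , _) st@(t∈ , _) u≢t ut
      with leafNbrs-after-pruning x∈F u∈ | leafNbrs-after-pruning x∈F t∈
    ... | inj₁ L′⊆L | inj₁ T′⊆T =
          saturated-apart (was-saturated su L′⊆L) (was-saturated st T′⊆T)
            (∈stepF⇒≢ F u∈) (∈stepF⇒≢ F t∈) u≢t (map-walk (stepF⊆ F) ut)
    ... | inj₁ L′⊆L | inj₂ (w , wx , w∈T′ , _) =
          saturated-apart-from-x (was-saturated su L′⊆L) (∈stepF⇒≢ F u∈)
            (map-walk (stepF⊆ F) ut ++ʷ reaches-x t∈ wx w∈T′)
    ... | inj₂ (w , wx , w∈L′ , _) | inj₁ T′⊆T =
          saturated-apart-from-x (was-saturated st T′⊆T) (∈stepF⇒≢ F t∈)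
            (map-walk (stepF⊆ F) (reverse-walk ut) ++ʷ reaches-x u∈ wx w∈L′)
    ... | inj₂ (w , wx , w∈L′ , _) | inj₂ (y , yx , y∈T′ , _) =
          neighbours-separated (edge-sym wx) (edge-sym yx) w≢y
            (map-walk (∈stepF⇒≢ F)
              (leafNbr-∈ F′ w∈L′ ∷⟨ edge-sym (leafNbr-edge F′ w∈L′) ⟩
                (ut ++ʷ (t∈ ∷⟨ leafNbr-edge F′ y∈T′ ⟩ [ leafNbr-∈ F′ y∈T′ ]))))
      where
      w≢y : w ≢ y
      w≢y refl = u≢t (leaf-nbr-unique (leafNbr-leaf F′ w∈L′)
                        u∈ (edge-sym (leafNbr-edge F′ w∈L′)) t∈ (edge-sym (leafNbr-edge F′ y∈T′)))

  prune-saturated : Balanced F → Saturated F v → Balanced (stepF F v)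
  prune-saturated bal sv@(v∈F , _) = pruning-balanced record
    { x∈F                    = v∈F
    ; leafCount≤b            = λ u∈ u∉A _ → leafCount≤b u∈ u∉A
    ; saturated-apart        = λ su st _ _ → saturated-apart su st
    ; saturated-apart-from-x = λ su u≢v → saturated-apart su sv u≢v
    }
    where open Balanced bal

  prune-unsaturated : (∀ {u} → u ∈ F → u ∉ A → leafCount F u < b) → x ∈ F → Balanced (stepF F x)
  prune-unsaturated {F} below x∈F = pruning-balanced record
    { x∈F                    = x∈F
    ; leafCount≤b            = λ u∈ u∉A _ → <⇒≤ (below u∈ u∉A)
    ; saturated-apart        = λ su _ _ _ _ _ → unsaturated su
    ; saturated-apart-from-x = λ su _ _ → unsaturated su
    }
    where
    unsaturated : ¬ Saturated F u
    unsaturated (u∈ , u∉A , count≡b) = <-irrefl count≡b (below u∈ u∉A)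

  saturated? : ∀ F u → Dec (Saturated F u)
  saturated? F u = (u ∈? F) ×-dec ¬? (u ∈? A) ×-dec (leafCount F u ≟ b)

  data AdmissibleIn : Subset n → List (Fin n) → Set where
    []  : AdmissibleIn F []
    _∷_ : Saturated F v → AdmissibleIn (stepF F v) vs → AdmissibleIn F (v ∷ vs)

  GoodIn : Subset n → Set
  GoodIn F = ∀ {vs u} → AdmissibleIn F vs → u ∈ reduce F vs → u ∉ A → leafCount (reduce F vs) u ≤ b

  Balanced⇒GoodIn : Balanced F → GoodIn F
  Balanced⇒GoodIn bal []          u∈ u∉A = Balanced.leafCount≤b bal u∈ u∉A
  Balanced⇒GoodIn bal (sv ∷ adm) u∈ u∉A = Balanced⇒GoodIn (prune-saturated bal sv) adm u∈ u∉A

  GoodIn-prune : GoodIn F → Saturated F v → GoodIn (stepF F v)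
  GoodIn-prune good sv adm = good (sv ∷ adm)

  reduce⊆ : ∀ vs → u ∈ reduce F vs → u ∈ F
  reduce⊆         []       u∈ = u∈
  reduce⊆ {F = F} (_ ∷ vs) u∈ = stepF⊆ F (reduce⊆ vs u∈)

  ∈reduce⇒∉ₗ : ∀ vs → u ∈ reduce F vs → u ∉ₗ vs
  ∈reduce⇒∉ₗ {F = F} (_ ∷ vs) u∈ (here refl)  = x∉stepF F (reduce⊆ vs u∈)
  ∈reduce⇒∉ₗ         (_ ∷ vs) u∈ (there u∈ₗ) = ∈reduce⇒∉ₗ vs u∈ u∈ₗ

  AdmissibleIn⇒All∈ : AdmissibleIn F vs → All (_∈ F) vs
  AdmissibleIn⇒All∈         []                 = []
  AdmissibleIn⇒All∈ {F = F} ((v∈F , _) ∷ adm) = v∈F ∷ All.map (stepF⊆ F) (AdmissibleIn⇒All∈ adm)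

  AdmissibleIn⇒admissible : AdmissibleIn F vs → Unique vs × All (_∉ A) vs × AdmissibleFrom b F vs
  AdmissibleIn⇒admissible [] = [] , [] , tt
  AdmissibleIn⇒admissible {F = F} {vs = v ∷ _} ((_ , v∉A , count≡b) ∷ adm)
    with AdmissibleIn⇒admissible adm
  ... | unique , outside-A , admissible =
        All.map (λ u∈ v≡u → x∉stepF F (subst (_∈ stepF F v) (sym v≡u) u∈)) (AdmissibleIn⇒All∈ adm) ∷ unique ,
        v∉A ∷ outside-A ,
        count≡b , admissible

  Good⇒GoodIn : Good adj A b → GoodIn (T adj)
  Good⇒GoodIn good {vs} {u} adm u∈ u∉A =
    ≮⇒≥ λ b<count → good (vs , u , AdmissibleIn⇒admissible adm , u∉A , ∈reduce⇒∉ₗ vs u∈ , b<count)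

data Role (n : ℕ) : Set where
  unused centre : Role n
  leafOf        : Fin n → Role n

module _ {n : ℕ} where

  isLeafOf : Fin n → Role n → Bool
  isLeafOf c (leafOf c′) = does (c ≟ᶠ c′)
  isLeafOf _ _           = false

  leavesOf : (Fin n → Role n) → Fin n → Subset n
  leavesOf role c = tabulate λ v → isLeafOf c (role v)

  ∈leavesOf⁻ : ∀ role {c v} → v ∈ leavesOf role c → role v ≡ leafOf c
  ∈leavesOf⁻ role {c} {v} v∈ with role v | x∈tabulate⁻ _ v∈
  ... | leafOf c′ | _ with c ≟ᶠ c′
  ...   | yes refl = refl

  ∈leavesOf⁺ : ∀ role {c v} → role v ≡ leafOf c → v ∈ leavesOf role c
  ∈leavesOf⁺ role {c} {v} role-v = x∈tabulate⁺ _ (subst (λ r → isLeafOf c r ≡ true) (sym role-v) is-leaf)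
    where
    is-leaf : does (c ≟ᶠ c) ≡ true
    is-leaf with c ≟ᶠ c
    ... | yes _  = refl
    ... | no c≢c = contradiction refl c≢c

module StarCovers {n : ℕ} {adj : Adj n} (tree : IsTree adj) (A : Subset n) (b : ℕ) where

  open Balance tree A b public

  private variable
    F : Subset n
    v x : Fin n

  record StarCover (F : Subset n) : Set where
    field
      role           : Fin n → Role n
      used⇒∈         : ∀ {v} → role v ≢ unused → v ∈ F
      leafOf⇒centre  : ∀ {v c} → role v ≡ leafOf c → role c ≡ centre
      leafOf⇒edge    : ∀ {v c} → role v ≡ leafOf c → Edge adj c v
      leafOf⇒∉A      : ∀ {v c} → role v ≡ leafOf c → v ∉ A
      centre⇒∉A      : ∀ {c} → role c ≡ centre → c ∉ A
      centre⇒≤b      : ∀ {c} → role c ≡ centre → ∣ leavesOf role c ∣ ≤ b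
      centre⇒hasLeaf : ∀ {c} → role c ≡ centre → ∃ λ v → role v ≡ leafOf c
      covers         : ∀ {v} → v ∈ F → ¬ InClosedNbhd adj A v → role v ≢ unused

  empty-cover : Empty F → StarCover F
  empty-cover empty = record
    { role           = λ _ → unused
    ; used⇒∈         = λ used → contradiction refl used
    ; leafOf⇒centre  = λ ()
    ; leafOf⇒edge    = λ ()
    ; leafOf⇒∉A      = λ ()
    ; centre⇒∉A      = λ ()
    ; centre⇒≤b      = λ ()
    ; centre⇒hasLeaf = λ ()
    ; covers         = λ v∈F → contradiction (_ , v∈F) empty
    }

  prune-uncovered : (∀ {v} → v ∈ F → v ∉ stepF F x → InClosedNbhd adj A v) →
                    StarCover (stepF F x) → StarCover F
  prune-uncovered {F} {x} pruned-near-A cover = record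
    { StarCover cover
    ; used⇒∈ = λ used → stepF⊆ F (used⇒∈ used)
    ; covers = covers′
    }
    where
    open StarCover cover
    covers′ : ∀ {v} → v ∈ F → ¬ InClosedNbhd adj A v → role v ≢ unused
    covers′ {v} v∈F v-needy with v ∈? stepF F x
    ... | yes v∈ = covers v∈ v-needy
    ... | no v∉  = contradiction (pruned-near-A v∈F v∉) v-needy

  module AddStar {F : Subset n} {x : Fin n} (x∈F : x ∈ F) (x∉A : x ∉ A)
                 (0<count : 0 < leafCount F x) (count≤b : leafCount F x ≤ b)
                 (cover : StarCover (stepF F x)) where

    private
      module C = StarCover cover
      L = LeafNbrs F x

      ≡centre⇒≢unused : ∀ {r : Role n} → r ≡ centre → r ≢ unused
      ≡centre⇒≢unused refl ()

      ≡leafOf⇒≢unused : ∀ {r : Role n} {c} → r ≡ leafOf c → r ≢ unused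
      ≡leafOf⇒≢unused refl ()

    role : Fin n → Role n
    role v with v ≟ᶠ x | v ∈? L
    ... | yes _ | _     = centre
    ... | no _  | yes _ = leafOf x
    ... | no _  | no _  = C.role v

    role-x : role x ≡ centre
    role-x with x ≟ᶠ x
    ... | yes _  = refl
    ... | no x≢x = contradiction refl x≢x

    role-leaf : ∀ {v} → v ∈ L → role v ≡ leafOf x
    role-leaf {v} v∈L with v ≟ᶠ x | v ∈? L
    ... | yes refl | _      = contradiction (leafNbr-edge F v∈L) edge-irrefl
    ... | no _     | yes _  = refl
    ... | no _     | no v∉L = contradiction v∈L v∉L

    role-used : ∀ {v} → C.role v ≢ unused → role v ≡ C.role v
    role-used {v} used with v ≟ᶠ x | v ∈? L
    ... | yes refl | _      = contradiction (C.used⇒∈ used) (x∉stepF F)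
    ... | no _     | yes v∈L = contradiction v∈L (∈stepF⇒∉LeafNbrs F (C.used⇒∈ used))
    ... | no _     | no _   = refl

    used⇒∈ : ∀ {v} → role v ≢ unused → v ∈ F
    used⇒∈ {v} used with v ≟ᶠ x | v ∈? L
    ... | yes refl | _      = x∈F
    ... | no _     | yes v∈L = leafNbr-∈ F v∈L
    ... | no _     | no _   = stepF⊆ F (C.used⇒∈ used)

    leafOf⇒centre : ∀ {v c} → role v ≡ leafOf c → role c ≡ centre
    leafOf⇒centre {v} rv with v ≟ᶠ x | v ∈? L
    leafOf⇒centre ()   | yes _ | _
    leafOf⇒centre refl | no _  | yes _ = role-x
    leafOf⇒centre rv   | no _  | no _  =
      trans (role-used (≡centre⇒≢unused (C.leafOf⇒centre rv))) (C.leafOf⇒centre rv)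

    leafOf⇒edge : ∀ {v c} → role v ≡ leafOf c → Edge adj c v
    leafOf⇒edge {v} rv with v ≟ᶠ x | v ∈? L
    leafOf⇒edge ()   | yes _ | _
    leafOf⇒edge refl | no _  | yes v∈L = leafNbr-edge F v∈L
    leafOf⇒edge rv   | no _  | no _    = C.leafOf⇒edge rv

    leafOf⇒∉A : ∀ {v c} → role v ≡ leafOf c → v ∉ A
    leafOf⇒∉A {v} rv with v ≟ᶠ x | v ∈? L
    leafOf⇒∉A ()   | yes _ | _
    leafOf⇒∉A refl | no _  | yes v∈L = leafNbr-∉A F v∈L
    leafOf⇒∉A rv   | no _  | no _    = C.leafOf⇒∉A rv

    centre⇒∉A : ∀ {c} → role c ≡ centre → c ∉ A
    centre⇒∉A {c} rc with c ≟ᶠ x | c ∈? L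
    centre⇒∉A _  | yes refl | _     = x∉A
    centre⇒∉A () | no _     | yes _
    centre⇒∉A rc | no _     | no _  = C.centre⇒∉A rc

    leaves-x⊆L : leavesOf role x ⊆ L
    leaves-x⊆L {v} v∈ = leaf-in-L (∈leavesOf⁻ role v∈)
      where
      leaf-in-L : role v ≡ leafOf x → v ∈ L
      leaf-in-L rv with v ≟ᶠ x | v ∈? L
      leaf-in-L () | yes _ | _
      leaf-in-L _  | no _  | yes v∈L = v∈L
      leaf-in-L rv | no _  | no _    = contradiction (C.used⇒∈ (≡centre⇒≢unused (C.leafOf⇒centre rv))) (x∉stepF F)

    leaves-old : ∀ {c} → c ≢ x → leavesOf role c ⊆ leavesOf C.role c
    leaves-old {c} c≢x {v} v∈ = old-leaf (∈leavesOf⁻ role v∈)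
      where
      old-leaf : role v ≡ leafOf c → v ∈ leavesOf C.role c
      old-leaf rv with v ≟ᶠ x | v ∈? L
      old-leaf ()   | yes _ | _
      old-leaf refl | no _  | yes _ = contradiction refl c≢x
      old-leaf rv   | no _  | no _  = ∈leavesOf⁺ C.role rv

    centre⇒≤b : ∀ {c} → role c ≡ centre → ∣ leavesOf role c ∣ ≤ b
    centre⇒≤b {c} rc with c ≟ᶠ x | c ∈? L
    centre⇒≤b _  | yes refl | _     = ≤-trans (p⊆q⇒∣p∣≤∣q∣ leaves-x⊆L) count≤b
    centre⇒≤b () | no _     | yes _
    centre⇒≤b rc | no c≢x   | no _  = ≤-trans (p⊆q⇒∣p∣≤∣q∣ (leaves-old c≢x)) (C.centre⇒≤b rc)

    centre⇒hasLeaf : ∀ {c} → role c ≡ centre → ∃ λ v → role v ≡ leafOf c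
    centre⇒hasLeaf {c} rc with c ≟ᶠ x | c ∈? L
    centre⇒hasLeaf _  | yes refl | _     = let (ℓ , ℓ∈L) = 0<∣p∣⇒Nonempty L 0<count in ℓ , role-leaf ℓ∈L
    centre⇒hasLeaf () | no _     | yes _
    centre⇒hasLeaf rc | no _     | no _  =
      let (v , rv) = C.centre⇒hasLeaf rc in v , trans (role-used (≡leafOf⇒≢unused rv)) rv

    covers : ∀ {v} → v ∈ F → ¬ InClosedNbhd adj A v → role v ≢ unused
    covers {v} v∈F v-needy with v ≟ᶠ x | v ∈? L
    ... | yes _  | _      = λ ()
    ... | no _   | yes _  = λ ()
    ... | no v≢x | no v∉L = C.covers (∈stepF⁺ v∈F v≢x v∉L) v-needy

  add-star : x ∈ F → x ∉ A → 0 < leafCount F x → leafCount F x ≤ b →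
             StarCover (stepF F x) → StarCover F
  add-star x∈F x∉A 0<count count≤b cover = record
    { role           = role
    ; used⇒∈         = used⇒∈
    ; leafOf⇒centre  = λ {v} → leafOf⇒centre {v}
    ; leafOf⇒edge    = leafOf⇒edge
    ; leafOf⇒∉A      = leafOf⇒∉A
    ; centre⇒∉A      = centre⇒∉A
    ; centre⇒≤b      = centre⇒≤b
    ; centre⇒hasLeaf = centre⇒hasLeaf
    ; covers         = covers
    }
    where open AddStar x∈F x∉A 0<count count≤b cover

  inClosedNbhd? : ∀ v → Dec (InClosedNbhd adj A v)
  inClosedNbhd? v = (v ∈? A) ⊎-dec any? (λ a → (a ∈? A) ×-dec (adj a v Bool.≟ true))

  pruned-near-A : x ∈ A → v ∈ F → v ∉ stepF F x → InClosedNbhd adj A v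
  pruned-near-A {x} {F = F} x∈A v∈F v∉ with ∉stepF⇒pruned v∈F v∉
  ... | inj₁ refl = inj₁ x∈A
  ... | inj₂ v∈L  = inj₂ (x , x∈A , leafNbr-edge F v∈L)

  pruned-without-leaves : ¬ 0 < leafCount F x → v ∈ F → v ∉ stepF F x → v ≡ x
  pruned-without-leaves no-leaves v∈F v∉ with ∉stepF⇒pruned v∈F v∉
  ... | inj₁ v≡x = v≡x
  ... | inj₂ v∈L = contradiction (x∈p⇒0<∣p∣ v∈L) no-leaves

  cover-unsaturated : (∀ {u} → u ∈ F → u ∉ A → leafCount F u < b) → NeedyNotIsolated F →
                      (∀ {x} → x ∈ F → StarCover (stepF F x)) → StarCover F
  cover-unsaturated {F} below needy cover-after
    with any? (λ x → (x ∈? F) ×-dec (inClosedNbhd? x ⊎-dec (0 <? leafCount F x)))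
  ... | yes (x , x∈F , reason) with x ∈? A | 0 <? leafCount F x
  ...   | yes x∈A | _           = prune-uncovered (pruned-near-A x∈A) (cover-after x∈F)
  ...   | no x∉A  | yes 0<count = add-star x∈F x∉A 0<count (<⇒≤ (below x∈F x∉A)) (cover-after x∈F)
  ...   | no _    | no no-leaves = prune-uncovered near-A (cover-after x∈F)
    where
    x∈N[A] : InClosedNbhd adj A x
    x∈N[A] = [ id , (λ 0<count → contradiction 0<count no-leaves) ]′ reason
    near-A : ∀ {v} → v ∈ F → v ∉ stepF F x → InClosedNbhd adj A v
    near-A v∈F v∉ = subst (InClosedNbhd adj A) (sym (pruned-without-leaves no-leaves v∈F v∉)) x∈N[A]
  cover-unsaturated {F} below needy cover-after | no none = empty-cover (min-degree≥2⇒Empty F 1<deg)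
    where
    -- every vertex of F is needy, so it has a neighbour y in F, and is no leaf as y has no leaf neighbours
    1<deg : ∀ {x} → x ∈ F → 1 < deg adj F x
    1<deg {x} x∈F with needy x∈F (λ x∈N[A] → none (x , x∈F , inj₁ x∈N[A]))
    ... | y , y∈F , xy = non-leaf⇒1<deg x∈F x∉Leaves y∈F xy
      where
      x∉Leaves : x ∉ Leaves adj F
      x∉Leaves x∈Leaves =
        none (y , y∈F , inj₂ (x∈p⇒0<∣p∣ (∈LeafNbrs⁺ F (edge-sym xy) x∈Leaves λ x∈A → none (x , x∈F , inj₁ (inj₁ x∈A)))))

  cover-step : 0 < b → GoodIn F → NeedyNotIsolated F →
               (∀ {x} → x ∈ F → GoodIn (stepF F x) → StarCover (stepF F x)) → StarCover F
  cover-step {F} 0<b good needy cover-after with any? (saturated? F)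
  ... | yes (x , sx@(x∈F , x∉A , count≡b)) =
        add-star x∈F x∉A (subst (0 <_) (sym count≡b) 0<b) (≤-reflexive count≡b) (cover-after x∈F (GoodIn-prune good sx))
  ... | no none-saturated =
        cover-unsaturated below needy λ x∈F → cover-after x∈F (Balanced⇒GoodIn (prune-unsaturated below x∈F))
    where
    below : ∀ {u} → u ∈ F → u ∉ A → leafCount F u < b
    below u∈ u∉A = ≤∧≢⇒< (good [] u∈ u∉A) λ count≡b → none-saturated (_ , u∈ , u∉A , count≡b)

  GoodIn⇒StarCover : 0 < b → GoodIn F → NeedyNotIsolated F → StarCover F
  GoodIn⇒StarCover {F} 0<b = build (suc ∣ F ∣) F ≤-refl
    where
    build : ∀ fuel F → ∣ F ∣ < fuel → GoodIn F → NeedyNotIsolated F → StarCover F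
    build (suc fuel) F ∣F∣<1+fuel good needy = cover-step 0<b good needy λ x∈F good′ →
      build fuel _ (<-≤-trans (∣stepF∣<∣F∣ x∈F) (s≤s⁻¹ ∣F∣<1+fuel)) good′ (NeedyNotIsolated-prune x∈F needy)

module GameFacts {n : ℕ} (adj : Adj n) (b : ℕ) (A : Subset n) where

  open Game adj b A public

  private variable
    D S X : Subset n
    v x : Fin n

  unclaimed-after-S : Unclaimed D S v → v ≢ x → Unclaimed D (S ∪ ⁅ x ⁆) v
  unclaimed-after-S (v∉D , v∉S) v≢x = v∉D , x∉p∪q⁺ v∉S (x≢y⇒x∉⁅y⁆ v≢x)

  unclaimed-after-D : Unclaimed D S v → v ∉ X → Unclaimed (D ∪ X) S v
  unclaimed-after-D (v∉D , v∉S) v∉X = x∉p∪q⁺ v∉D v∉X , v∉S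

  unclaimed⇒¬AllClaimed : Unclaimed D S v → ¬ AllClaimed D S
  unclaimed⇒¬AllClaimed {v = v} (v∉D , v∉S) all-claimed = [ v∉D , v∉S ]′ (all-claimed v)

  unclaimed? : ∀ D S → Dec (∃ λ v → Unclaimed D S v)
  unclaimed? D S = any? λ v → ¬? (v ∈? D) ×-dec ¬? (v ∈? S)

  ¬unclaimed⇒AllClaimed : ¬ (∃ λ v → Unclaimed D S v) → AllClaimed D S
  ¬unclaimed⇒AllClaimed {D} {S} none v with v ∈? D | v ∈? S
  ... | yes v∈D | _       = inj₁ v∈D
  ... | no _    | yes v∈S = inj₂ v∈S
  ... | no v∉D  | no v∉S  = ⊥-elim (none (v , v∉D , v∉S))

  legal-∅ : LegalD D S ∅
  legal-∅ = subst (_≤ b) (sym (∣⊥∣≡0 n)) z≤n , λ v∈∅ → contradiction v∈∅ ∉⊥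

module PairingStrategy {n : ℕ} {adj : Adj n} (tree : IsTree adj) (A : Subset n) (b : ℕ) (0<b : 0 < b)
                       (cover : StarCovers.StarCover tree A b (T adj)) where

  open StarCovers tree A b using (edge-sym)
  open StarCovers.StarCover cover
  open GameFacts adj b A

  private variable
    D S X : Subset n
    c x : Fin n

  InStar : Fin n → Fin n → Set
  InStar c v = v ≡ c ⊎ role v ≡ leafOf c

  Untouched : Subset n → Subset n → Fin n → Set
  Untouched D S c = ∀ {v} → InStar c v → Unclaimed D S v

  Secured : Subset n → Fin n → Set
  Secured D c = c ∈ D ⊎ (∀ {v} → role v ≡ leafOf c → v ∈ D)

  Invariant : Subset n → Subset n → Set
  Invariant D S = ∀ {c} → role c ≡ centre → Untouched D S c ⊎ Secured D c

  secured-mono : D ⊆ X → Secured D c → Secured X c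
  secured-mono D⊆X (inj₁ c∈D)    = inj₁ (D⊆X c∈D)
  secured-mono D⊆X (inj₂ leaves) = inj₂ λ rv → D⊆X (leaves rv)

  all-secured⇒Goal : (∀ {c} → role c ≡ centre → Secured D c) → Goal D
  all-secured⇒Goal {D} secured v v-needy = dominated (role v) refl
    where
    dominated : ∀ r → role v ≡ r → Dominated adj D v
    dominated unused     rv = contradiction rv (covers ∈⊤ v-needy)
    dominated centre     rv with secured rv
    ... | inj₁ v∈D    = inj₁ v∈D
    ... | inj₂ leaves = let (ℓ , rℓ) = centre⇒hasLeaf rv in inj₂ (ℓ , leaves rℓ , leafOf⇒edge rℓ)
    dominated (leafOf c) rv with secured (leafOf⇒centre rv)
    ... | inj₁ c∈D    = inj₂ (c , c∈D , edge-sym (leafOf⇒edge rv))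
    ... | inj₂ leaves = inj₁ (leaves rv)

  centre≢leaf : ∀ {v c′} → role c ≡ centre → role v ≡ leafOf c′ → v ≢ c
  centre≢leaf rc rv refl with trans (sym rc) rv
  ... | ()

  stars-disjoint : ∀ {c′ v} → role c ≡ centre → role c′ ≡ centre → c′ ≢ c → InStar c v → ¬ InStar c′ v
  stars-disjoint rc rc′ c′≢c (inj₁ refl) (inj₁ refl) = c′≢c refl
  stars-disjoint rc rc′ c′≢c (inj₁ refl) (inj₂ rv′) = centre≢leaf rc rv′ refl
  stars-disjoint rc rc′ c′≢c (inj₂ rv)   (inj₁ refl) = centre≢leaf rc′ rv refl
  stars-disjoint rc rc′ c′≢c (inj₂ rv)   (inj₂ rv′) with trans (sym rv) rv′
  ... | refl = c′≢c refl

  keep : (∀ {v} → InStar c v → v ≢ x × v ∉ X) →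
         Untouched D S c ⊎ Secured D c → Untouched (D ∪ X) (S ∪ ⁅ x ⁆) c ⊎ Secured (D ∪ X) c
  keep avoid (inj₁ untouched) = inj₁ λ v∈star →
    let (v≢x , v∉X) = avoid v∈star in unclaimed-after-S (unclaimed-after-D (untouched v∈star) v∉X) v≢x
  keep _ (inj₂ secured) = inj₂ (secured-mono (p⊆p∪q _) secured)

  after-unused : role x ≡ unused → Invariant D S → Invariant (D ∪ ∅) (S ∪ ⁅ x ⁆)
  after-unused {x} rx inv {c} rc = keep (λ v∈star → x∉star v∈star , ∉⊥) (inv rc)
    where
    x∉star : ∀ {v} → InStar c v → v ≢ x
    x∉star (inj₁ refl) refl with trans (sym rx) rc
    ... | ()
    x∉star (inj₂ rv) refl with trans (sym rx) rv
    ... | ()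

  after-reply : ∀ {c₀} → role c₀ ≡ centre → InStar c₀ x → (∀ {v} → v ∈ X → InStar c₀ v) →
                Secured (D ∪ X) c₀ → Invariant D S → Invariant (D ∪ X) (S ∪ ⁅ x ⁆)
  after-reply {x = x} {X = X} {c₀ = c₀} rc₀ x∈star X⊆star secured inv {c} rc with c ≟ᶠ c₀
  ... | yes refl = inj₂ secured
  ... | no c≢c₀  = keep avoid (inv rc)
    where
    avoid : ∀ {v} → InStar c v → v ≢ x × v ∉ X
    avoid v∈star = (λ v≡x → stars-disjoint rc₀ rc c≢c₀ x∈star (subst (InStar c) v≡x v∈star))
                 , (λ v∈X → stars-disjoint rc₀ rc c≢c₀ (X⊆star v∈X) v∈star)

  touched-star : ∀ x → role x ≡ unused ⊎ ∃ λ c → role c ≡ centre × InStar c x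
  touched-star x with role x in rx
  ... | unused   = inj₁ refl
  ... | centre   = inj₂ (x , rx , inj₁ refl)
  ... | leafOf c = inj₂ (c , leafOf⇒centre rx , inj₂ refl)

  reply : ∀ {c₀} → InStar c₀ x → Subset n
  reply {c₀ = c₀} (inj₁ _) = leavesOf role c₀
  reply {c₀ = c₀} (inj₂ _) = ⁅ c₀ ⁆

  module _ {c₀ : Fin n} (rc₀ : role c₀ ≡ centre) where

    reply-in-star : ∀ {v} (x∈star : InStar c₀ x) → v ∈ reply x∈star → InStar c₀ v
    reply-in-star (inj₁ _) v∈ = inj₂ (∈leavesOf⁻ role v∈)
    reply-in-star (inj₂ _) v∈ = inj₁ (x∈⁅y⁆⇒x≡y c₀ v∈)

    reply-≢ : ∀ {v} (x∈star : InStar c₀ x) → v ∈ reply x∈star → v ≢ x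
    reply-≢ (inj₁ refl) v∈     = centre≢leaf rc₀ (∈leavesOf⁻ role v∈)
    reply-≢ (inj₂ rx)   v∈ v≡x = centre≢leaf rc₀ rx (trans (sym v≡x) (x∈⁅y⁆⇒x≡y c₀ v∈))

    reply-∉A : ∀ {v} (x∈star : InStar c₀ x) → v ∈ reply x∈star → v ∉ A
    reply-∉A (inj₁ _) v∈ = leafOf⇒∉A (∈leavesOf⁻ role v∈)
    reply-∉A (inj₂ _) v∈ = subst (_∉ A) (sym (x∈⁅y⁆⇒x≡y c₀ v∈)) (centre⇒∉A rc₀)

    reply-size : (x∈star : InStar c₀ x) → ∣ reply x∈star ∣ ≤ b
    reply-size (inj₁ _) = centre⇒≤b rc₀
    reply-size (inj₂ _) = subst (_≤ b) (sym (∣⁅x⁆∣≡1 c₀)) 0<b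

    reply-secures : (x∈star : InStar c₀ x) → Secured (D ∪ reply x∈star) c₀
    reply-secures (inj₁ _) = inj₂ λ rv → x∈p∪q⁺ (inj₂ (∈leavesOf⁺ role rv))
    reply-secures (inj₂ _) = inj₁ (x∈p∪q⁺ (inj₂ (x∈⁅x⁆ c₀)))

  respond : Invariant D S → ∃ λ X → LegalD D (S ∪ ⁅ x ⁆) X × Invariant (D ∪ X) (S ∪ ⁅ x ⁆)
  respond {x = x} inv with touched-star x
  ... | inj₁ rx = ∅ , legal-∅ , after-unused rx inv
  ... | inj₂ (c₀ , rc₀ , x∈star) with inv rc₀
  ...   | inj₂ secured =
          ∅ , legal-∅ , after-reply rc₀ x∈star (λ v∈∅ → contradiction v∈∅ ∉⊥) (secured-mono (p⊆p∪q ∅) secured) inv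
  ...   | inj₁ untouched =
          reply x∈star , (reply-size rc₀ x∈star , legal) ,
          after-reply rc₀ x∈star (reply-in-star rc₀ x∈star) (reply-secures rc₀ x∈star) inv
    where
    legal : ∀ {v} → v ∈ reply x∈star → Unclaimed _ (_ ∪ ⁅ x ⁆) v × v ∉ A
    legal v∈ = unclaimed-after-S (untouched (reply-in-star rc₀ x∈star v∈)) (reply-≢ rc₀ x∈star v∈) ,
               reply-∉A rc₀ x∈star v∈

  ¬unclaimed⇒secured : ¬ (∃ λ v → Unclaimed D S v) → Invariant D S → ∀ {c} → role c ≡ centre → Secured D c
  ¬unclaimed⇒secured none inv rc with inv rc
  ... | inj₁ untouched = ⊥-elim (none (_ , untouched (inj₁ refl)))
  ... | inj₂ secured   = secured

  wins-from : ∀ fuel {D S} → ∣ ∁ S ∣ < fuel → Invariant D S → WinS D S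
  wins-from (suc fuel) {D} {S} bound inv with unclaimed? D S
  ... | no none  = endS (¬unclaimed⇒AllClaimed none) (all-secured⇒Goal (¬unclaimed⇒secured none inv))
  ... | yes some = moveS some reply-to
    where
    reply-to : ∀ x → Unclaimed D S x → WinD D (S ∪ ⁅ x ⁆)
    reply-to x (_ , x∉S) with respond {x = x} inv | unclaimed? D (S ∪ ⁅ x ⁆)
    ... | X , legal , inv′ | yes some′ =
          moveD some′ X legal (wins-from fuel (<-≤-trans (x∉p⇒∣∁[p∪⁅x⁆]∣<∣∁p∣ x∉S) (s≤s⁻¹ bound)) inv′)
    ... | X , legal , inv′ | no none′ =
          endD (¬unclaimed⇒AllClaimed none′) (all-secured⇒Goal λ rc → secured-mono D∪X⊆D (¬unclaimed⇒secured none″ inv′ rc))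
      where
      D∪X⊆D : D ∪ X ⊆ D
      D∪X⊆D v∈ = [ id , (λ v∈X → ⊥-elim (none′ (_ , proj₁ (proj₂ legal v∈X)))) ]′ (x∈p∪q⁻ D X v∈)
      none″ : ¬ (∃ λ v → Unclaimed (D ∪ X) (S ∪ ⁅ x ⁆) v)
      none″ (v , v∉D∪X , v∉S′) = none′ (v , (λ v∈D → v∉D∪X (x∈p∪q⁺ (inj₁ v∈D))) , v∉S′)

  dominator-wins : DominatorWinsStallerFirst adj b A
  dominator-wins = wins-from (suc ∣ ∁ (∅ {n}) ∣) ≤-refl λ _ → inj₁ λ _ → ∉⊥ , ∉⊥

module StallerStrategy {n : ℕ} {adj : Adj n} (tree : IsTree adj) (A : Subset n) (b : ℕ) where

  open Pruning tree A
  open GameFacts adj b A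

  private variable
    F D S X : Subset n
    u v w ℓ : Fin n
    vs : List (Fin n)

  Disjoint : Subset n → Subset n → Set
  Disjoint D S = ∀ {v} → v ∈ D → v ∉ S

  Enclosed : Subset n → Fin n → Set
  Enclosed S w = w ∈ S × (∀ {z} → Edge adj w z → z ∈ S)

  disjoint-after-S : Disjoint D S → v ∉ D → Disjoint D (S ∪ ⁅ v ⁆)
  disjoint-after-S disjoint v∉D y∈D =
    x∉p∪q⁺ (disjoint y∈D) λ y∈⁅v⁆ → v∉D (subst (_∈ _) (x∈⁅y⁆⇒x≡y _ y∈⁅v⁆) y∈D)

  disjoint-after-D : Disjoint D S → LegalD D S X → Disjoint (D ∪ X) S
  disjoint-after-D {D} {X = X} disjoint (_ , free) y∈ =
    [ disjoint , (λ y∈X → proj₂ (proj₁ (free y∈X))) ]′ (x∈p∪q⁻ D X y∈)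

  enclosed-mono : S ⊆ X → Enclosed S w → Enclosed X w
  enclosed-mono S⊆X (w∈S , nbrs∈S) = S⊆X w∈S , λ wz → S⊆X (nbrs∈S wz)

  module _ {w : Fin n} (w-needy : ¬ InClosedNbhd adj A w) where

    enclosed-undominated : Enclosed S w → Disjoint D S → ¬ Dominated adj D w
    enclosed-undominated (w∈S , _)      disjoint (inj₁ w∈D)            = disjoint w∈D w∈S
    enclosed-undominated (_ , nbrs∈S) disjoint (inj₂ (z , z∈D , wz)) = disjoint z∈D (nbrs∈S wz)

    enclosed-lostS : Enclosed S w → Disjoint D S → ¬ WinS D S
    enclosed-lostD : Enclosed S w → Disjoint D S → ¬ WinD D S

    enclosed-lostS enclosed disjoint (endS _ goal) = enclosed-undominated enclosed disjoint (goal w w-needy)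
    enclosed-lostS enclosed disjoint (moveS (v , v-free@(v∉D , _)) staller-move) =
      enclosed-lostD (enclosed-mono (p⊆p∪q _) enclosed) (disjoint-after-S disjoint v∉D) (staller-move v v-free)
    enclosed-lostD enclosed disjoint (endD _ goal) = enclosed-undominated enclosed disjoint (goal w w-needy)
    enclosed-lostD enclosed disjoint (moveD _ X legal win) =
      enclosed-lostS enclosed (disjoint-after-D disjoint legal) win

  -- F is the forest left after the hubs claimed so far; vs are the hubs still to come and u the last.
  record StallerPosition (F D S : Subset n) (vs : List (Fin n)) (u : Fin n) : Set where
    field
      inside-free      : ∀ {v} → v ∈ F → Unclaimed D S v
      boundary-staller : ∀ {z w} → z ∉ F → w ∈ F → Edge adj z w → z ∈ S
      staller-∉A       : ∀ {v} → v ∈ S → v ∉ A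
      disjoint         : Disjoint D S
      targets-free     : ∀ {v} → v ∈ S → v ∉ₗ vs × v ≢ u

  initial-position : StallerPosition (T adj) ∅ ∅ vs u
  initial-position = record
    { inside-free      = λ _ → ∉⊥ , ∉⊥
    ; boundary-staller = λ z∉T _ _ → contradiction ∈⊤ z∉T
    ; staller-∉A       = λ v∈∅ → contradiction v∈∅ ∉⊥
    ; disjoint         = λ _ → ∉⊥
    ; targets-free     = λ v∈∅ → contradiction v∈∅ ∉⊥
    }

  module _ (pos : StallerPosition F D S vs u) where

    open StallerPosition pos

    hub∈F : 0 < leafCount F v → v ∉ S → v ∈ F
    hub∈F {v} 0<count v∉S with 0<∣p∣⇒Nonempty (LeafNbrs F v) 0<count
    ... | ℓ , ℓ∈L = decidable-stable (v ∈? F) λ v∉F → v∉S (boundary-staller v∉F (leafNbr-∈ F ℓ∈L) (leafNbr-edge F ℓ∈L))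

    leaf-free : ℓ ∈ LeafNbrs F v → Unclaimed D (S ∪ ⁅ v ⁆) ℓ
    leaf-free ℓ∈L = unclaimed-after-S (inside-free (leafNbr-∈ F ℓ∈L)) (≢-sym (edge⇒≢ (leafNbr-edge F ℓ∈L)))

    -- Staller takes ℓ next: its neighbours are v and boundary vertices, all Staller's.
    unclaimed-leaf-lost : v ∈ F → v ∉ A → ℓ ∈ LeafNbrs F v → LegalD D (S ∪ ⁅ v ⁆) X → ℓ ∉ X →
                          ¬ WinS (D ∪ X) (S ∪ ⁅ v ⁆)
    unclaimed-leaf-lost {v} {ℓ} v∈F v∉A ℓ∈L legal ℓ∉X (endS all-claimed _) =
      unclaimed⇒¬AllClaimed (unclaimed-after-D (leaf-free ℓ∈L) ℓ∉X) all-claimed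
    unclaimed-leaf-lost {v} {ℓ} {X} v∈F v∉A ℓ∈L legal ℓ∉X (moveS _ staller-move) =
      enclosed-lostD ℓ-needy (x∈p∪q⁺ (inj₂ (x∈⁅x⁆ ℓ)) , nbrs∈S′)
        (disjoint-after-S (disjoint-after-D (disjoint-after-S disjoint (proj₁ (inside-free v∈F))) legal)
                          (proj₁ ℓ-free))
        (staller-move ℓ ℓ-free)
      where
      ℓ-free = unclaimed-after-D (leaf-free ℓ∈L) ℓ∉X
      ℓ∈F = leafNbr-∈ F ℓ∈L
      nbr-staller : ∀ {z} → Edge adj ℓ z → z ∈ S ∪ ⁅ v ⁆
      nbr-staller {z} ℓz with z ∈? F
      ... | yes z∈F = x∈p∪q⁺ (inj₂ (subst (_∈ ⁅ v ⁆) (sym (leafNbr-only-nbr F ℓ∈L v∈F z∈F ℓz)) (x∈⁅x⁆ v)))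
      ... | no z∉F  = x∈p∪q⁺ (inj₁ (boundary-staller z∉F ℓ∈F (edge-sym ℓz)))
      nbrs∈S′ : ∀ {z} → Edge adj ℓ z → z ∈ (S ∪ ⁅ v ⁆) ∪ ⁅ ℓ ⁆
      nbrs∈S′ ℓz = x∈p∪q⁺ (inj₁ (nbr-staller ℓz))
      ℓ-needy : ¬ InClosedNbhd adj A ℓ
      ℓ-needy (inj₁ ℓ∈A) = leafNbr-∉A F ℓ∈L ℓ∈A
      ℓ-needy (inj₂ (a , a∈A , aℓ)) = [ (λ a∈S → staller-∉A a∈S a∈A) , (λ a∈⁅v⁆ → v∉A (subst (_∈ A) (x∈⁅y⁆⇒x≡y v a∈⁅v⁆) a∈A)) ]′
                                        (x∈p∪q⁻ S ⁅ v ⁆ (nbr-staller (edge-sym aℓ)))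

    forced-reply : v ∈ F → v ∉ A → 0 < leafCount F v → WinS D S →
                   ∃ λ X → LegalD D (S ∪ ⁅ v ⁆) X × LeafNbrs F v ⊆ X × WinS (D ∪ X) (S ∪ ⁅ v ⁆)
    forced-reply v∈F _ _ (endS all-claimed _) = ⊥-elim (unclaimed⇒¬AllClaimed (inside-free v∈F) all-claimed)
    forced-reply {v} v∈F v∉A 0<count (moveS _ staller-move) with staller-move v (inside-free v∈F)
    ... | endD all-claimed _ =
          let (ℓ , ℓ∈L) = 0<∣p∣⇒Nonempty (LeafNbrs F v) 0<count in
          ⊥-elim (unclaimed⇒¬AllClaimed (leaf-free ℓ∈L) all-claimed)
    ... | moveD _ X legal win with any? (λ ℓ → (ℓ ∈? LeafNbrs F v) ×-dec ¬? (ℓ ∈? X))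
    ...   | yes (ℓ , ℓ∈L , ℓ∉X) = ⊥-elim (unclaimed-leaf-lost v∈F v∉A ℓ∈L legal ℓ∉X win)
    ...   | no none = X , legal , (λ {ℓ} ℓ∈L → decidable-stable (ℓ ∈? X) λ ℓ∉X → none (ℓ , ℓ∈L , ℓ∉X)) , win

  position-after-hub : StallerPosition F D S (v ∷ vs) u → v ∈ F → v ∉ A → v ∉ₗ vs → v ≢ u →
                       LegalD D (S ∪ ⁅ v ⁆) X → X ⊆ LeafNbrs F v →
                       StallerPosition (stepF F v) (D ∪ X) (S ∪ ⁅ v ⁆) vs u
  position-after-hub {F} {D} {S} {v} {vs} {u} {X} pos v∈F v∉A v∉vs v≢u legal X⊆L = record
    { inside-free      = λ y∈ → unclaimed-after-S (unclaimed-after-D (inside-free (stepF⊆ F y∈))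
                                    (λ y∈X → ∈stepF⇒∉LeafNbrs F y∈ (X⊆L y∈X))) (∈stepF⇒≢ F y∈)
    ; boundary-staller = boundary′
    ; staller-∉A       = λ y∈ → [ staller-∉A , (λ y∈⁅v⁆ → subst (_∉ A) (sym (x∈⁅y⁆⇒x≡y v y∈⁅v⁆)) v∉A) ]′ (x∈p∪q⁻ S _ y∈)
    ; disjoint         = disjoint-after-D (disjoint-after-S disjoint (proj₁ (inside-free v∈F))) legal
    ; targets-free     = λ y∈ → [ (λ y∈S → let (y∉vvs , y≢u) = targets-free y∈S in y∉vvs ∘ there , y≢u)
                                 , (λ y∈⁅v⁆ → subst (λ y → y ∉ₗ vs × y ≢ u) (sym (x∈⁅y⁆⇒x≡y v y∈⁅v⁆)) (v∉vs , v≢u))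
                                 ]′ (x∈p∪q⁻ S _ y∈)
    }
    where
    open StallerPosition pos
    boundary′ : ∀ {z w} → z ∉ stepF F v → w ∈ stepF F v → Edge adj z w → z ∈ S ∪ ⁅ v ⁆
    boundary′ {z} z∉ w∈ zw with z ∈? F
    ... | yes z∈F = x∈p∪q⁺ (inj₂ (subst (_∈ ⁅ v ⁆) (sym (pruned-nbr≡x v∈F w∈ z∈F z∉ (edge-sym zw))) (x∈⁅x⁆ v)))
    ... | no z∉F  = x∈p∪q⁺ (inj₁ (boundary-staller z∉F (stepF⊆ F w∈) zw))

  staller-wins : 0 < b → ∀ vs → StallerPosition F D S vs u → AdmissibleFrom b F vs → Unique vs → All (_∉ A) vs →
                 u ∉ A → u ∉ₗ vs → b < leafCount (reduce F vs) u → ¬ WinS D S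
  staller-wins {F} {D} {S} {u} _ [] pos _ _ _ u∉A _ b<count win = last-hub (forced-reply pos u∈F u∉A 0<count win)
    where
    0<count = ≤-trans (s≤s z≤n) b<count
    u∈F = hub∈F pos 0<count λ u∈S → proj₂ (StallerPosition.targets-free pos u∈S) refl
    last-hub : ¬ ∃ λ X → LegalD D (S ∪ ⁅ u ⁆) X × LeafNbrs F u ⊆ X × WinS (D ∪ X) (S ∪ ⁅ u ⁆)
    last-hub (_ , (∣X∣≤b , _) , L⊆X , _) = <⇒≱ b<count (≤-trans (p⊆q⇒∣p∣≤∣q∣ L⊆X) ∣X∣≤b)
  staller-wins {F} {D} {S} {u} 0<b (v ∷ vs) pos (count≡b , adm) (v∉vs ∷ unique) (v∉A ∷ outside) u∉A u∉vvs b<count win =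
    next-hub (forced-reply pos v∈F v∉A 0<count win)
    where
    0<count = subst (0 <_) (sym count≡b) 0<b
    v∈F = hub∈F pos 0<count λ v∈S → proj₁ (StallerPosition.targets-free pos v∈S) (here refl)
    next-hub : ¬ ∃ λ X → LegalD D (S ∪ ⁅ v ⁆) X × LeafNbrs F v ⊆ X × WinS (D ∪ X) (S ∪ ⁅ v ⁆)
    next-hub (X , legal@(∣X∣≤b , _) , L⊆X , win′) =
      staller-wins 0<b vs
        (position-after-hub pos v∈F v∉A (All¬⇒¬Any v∉vs) (λ v≡u → u∉vvs (here (sym v≡u))) legal
          (p⊆q∧∣q∣≤∣p∣⇒q⊆p L⊆X (subst (∣ X ∣ ≤_) (sym count≡b) ∣X∣≤b)))
        adm unique outside u∉A (u∉vvs ∘ there) b<count win′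

  problematic⇒¬win : 0 < b → ∀ {vs u} → Problematic adj A b vs u → ¬ DominatorWinsStallerFirst adj b A
  problematic⇒¬win 0<b ((unique , outside , adm) , u∉A , u∉vs , b<count) =
    staller-wins 0<b _ initial-position adm unique outside u∉A u∉vs b<count

theorem4p2 : (n : ℕ) → 2 ≤ n → (adj : Adj n) → IsTree adj →
    (b : ℕ) → 1 ≤ b → (A : Subset n) →
    (DominatorWinsStallerFirst adj b A → Good adj A b) ×
    (Good adj A b → DominatorWinsStallerFirst adj b A)
theorem4p2 n 2≤n adj tree b 1≤b A = winning⇒good , good⇒winning
  where
  open StarCovers tree A b using (GoodIn⇒StarCover; Good⇒GoodIn; T-NeedyNotIsolated)

  winning⇒good : DominatorWinsStallerFirst adj b A → Good adj A b
  winning⇒good win (_ , _ , problematic) = StallerStrategy.problematic⇒¬win tree A b 1≤b problematic win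

  good⇒winning : Good adj A b → DominatorWinsStallerFirst adj b A
  good⇒winning good =
    PairingStrategy.dominator-wins tree A b 1≤b
      (GoodIn⇒StarCover 1≤b (Good⇒GoodIn good) (T-NeedyNotIsolated 2≤n))
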